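{- Let $(V,d)$ be a finite metric space, $k$ a positive integer and $R>0$. Let $G_R$ be the graph on $V$ with edge set $\{uv: d(u,v)\le R\}$, and for each connected component $C$ of $G_R$ let $T_C$ be a minimum-weight spanning tree of $C$ in $G_R$. Call $C$ small if $w(T_C)<2R$ and large otherwise. Assume $\sum_{C}\big\lfloor \frac{w(T_C)+2R}{2R}\big\rfloor = k$, the sum being over all components $C$ of $G_R$. Let $\mathcal T$ be the collection consisting of $T_C$ for every small $C$, together with, for every large $C$, a family of edge-disjoint subtrees of $T_C$ whose union is $T_C$, each of weight at most $4R$ and all but at most one of them of weight at least $2R$. Suppose $\mathcal T=\{T_1,\dots,T_k\}$ consists of exactly $k$ trees. Then $$\sum_{i=1}^k w(T_i)\le 2\,\mathrm{OPT}_{1,k},$$ where $\mathrm{OPT}_{1,k}$ is the minimum of $\sum_{i=1}^k w(\hat T_i)$ over all tree covers $\{\hat T_1,\dots,\hat T_k\}$ of $(V,d)$ of size $k$.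
   Context: A finite metric space $(V,d)$ is identified with the complete graph on $V$ with edge weights $d$. A tree is a tree in this complete graph on some subset of $V$ (a single vertex is allowed); its weight is $w(T)=\sum_{uv\in E(T)} d(u,v)$. A tree cover of size $k$ is a collection of $k$ trees whose vertex sets together cover $V$; the trees need not be disjoint.
   Formalization: The metric d and the radius R take only rational values. -}

module Defs where

open import Data.Nat using (ℕ; suc)
open import Data.Fin using (Fin)
open import Data.Integer using (ℤ)
open import Data.Rational using (ℚ; 0ℚ; 1ℚ; _+_; _*_; _≤_; _<_; _÷_; floor)
open import Data.Rational.Properties using (+-mono-<; pos⇒nonZero)
open import Data.Rational.Base using (positive)
open import Data.List using (List; []; _∷_; length; foldr; lookup)
open import Data.List.Membership.Propositional using (_∈_)
open import Data.List.Relation.Unary.All using (All)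
open import Data.List.Relation.Unary.Unique.Propositional using (Unique)
open import Data.Product using (Σ; _×_; _,_; proj₁; proj₂; ∃)
open import Data.Sum using (_⊎_)
open import Relation.Binary.PropositionalEquality using (_≡_; _≢_)
open import Relation.Nullary using (¬_)
open import Function.Bundles using (_⇔_)

record IsMetric {n : ℕ} (d : Fin n → Fin n → ℚ) : Set where
  field
    zero-iff : ∀ x y → (d x y ≡ 0ℚ) ⇔ (x ≡ y)
    symm     : ∀ x y → d x y ≡ d y x
    triangle : ∀ x y z → d x z ≤ d x y + d y z

-- Trees in the complete graph on (a subset of) Fin n.
-- An edge is an (ordered) pair; it is read as the unordered pair {u,v}.

Edge : ℕ → Set
Edge n = Fin n × Fin n

record Tree (n : ℕ) : Set where
  constructor mkTree
  field
    verts : List (Fin n)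
    edges : List (Edge n)
open Tree public

EdgeIn : ∀ {n} → Edge n → List (Edge n) → Set
EdgeIn (u , v) E = ((u , v) ∈ E) ⊎ ((v , u) ∈ E)

data Conn {n : ℕ} (E : List (Edge n)) : Fin n → Fin n → Set where
  here : ∀ {u} → Conn E u u
  step : ∀ {u w v} → EdgeIn (u , w) E → Conn E w v → Conn E u v

record IsTree {n : ℕ} (T : Tree n) : Set where
  field
    nonempty  : verts T ≢ []
    distinct  : Unique (verts T)
    endpoints : All (λ e → (proj₁ e ∈ verts T) × (proj₂ e ∈ verts T)) (edges T)
    connected : ∀ u v → u ∈ verts T → v ∈ verts T → Conn (edges T) u v
    edgeCount : suc (length (edges T)) ≡ length (verts T)

weight : ∀ {n} → (Fin n → Fin n → ℚ) → Tree n → ℚ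
weight d T = foldr (λ e acc → d (proj₁ e) (proj₂ e) + acc) 0ℚ (edges T)

sumℚ : List ℚ → ℚ
sumℚ = foldr _+_ 0ℚ

sumFinℚ : ∀ {k} → (Fin k → ℚ) → ℚ
sumFinℚ {ℕ.zero} f = 0ℚ
sumFinℚ {suc k} f = f Fin.zero + sumFinℚ (λ i → f (Fin.suc i))

sumFinℤ : ∀ {k} → (Fin k → ℤ) → ℤ
sumFinℤ {ℕ.zero} f = ℤ.pos 0
sumFinℤ {suc k} f = f Fin.zero Data.Integer.+ sumFinℤ (λ i → f (Fin.suc i))
  where import Data.Integer

IsTreeCover : ∀ {n k} → (Fin k → Tree n) → Set
IsTreeCover {n} {k} T = (∀ i → IsTree (T i)) × (∀ (v : Fin n) → ∃ λ i → v ∈ verts (T i))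

data GRConn {n : ℕ} (d : Fin n → Fin n → ℚ) (R : ℚ) : Fin n → Fin n → Set where
  here : ∀ {u} → GRConn d R u u
  step : ∀ {u w v} → d u w ≤ R → GRConn d R w v → GRConn d R u v

record IsComponent {n : ℕ} (d : Fin n → Fin n → ℚ) (R : ℚ) (C : List (Fin n)) : Set where
  field
    nonempty  : C ≢ []
    connected : ∀ u v → u ∈ C → v ∈ C → GRConn d R u v
    closed    : ∀ u v → u ∈ C → d u v ≤ R → v ∈ C

SameSet : ∀ {n} → List (Fin n) → List (Fin n) → Set
SameSet A B = ∀ v → (v ∈ A) ⇔ (v ∈ B)

IsSpanningTreeInGR : ∀ {n} → (Fin n → Fin n → ℚ) → ℚ → List (Fin n) → Tree n → Set
IsSpanningTreeInGR d R C T =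
  IsTree T × All (λ e → d (proj₁ e) (proj₂ e) ≤ R) (edges T) × SameSet (verts T) C

IsMSTInGR : ∀ {n} → (Fin n → Fin n → ℚ) → ℚ → List (Fin n) → Tree n → Set
IsMSTInGR d R C T =
  IsSpanningTreeInGR d R C T ×
  (∀ T' → IsSpanningTreeInGR d R C T' → weight d T ≤ weight d T')

twoPos : ∀ {R} → 0ℚ < R → 0ℚ < R + R
twoPos h = +-mono-< h h

allot : (R : ℚ) → 0ℚ < R → ℚ → ℤ
allot R h w = floor (_÷_ (w + (R + R)) (R + R) {{pos⇒nonZero (R + R) {{positive (twoPos h)}}}})

IsSubtree : ∀ {n} → Tree n → Tree n → Set
IsSubtree T S =
  (∀ v → v ∈ verts S → v ∈ verts T) × All (λ e → EdgeIn e (edges T)) (edges S)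

IsLargeSplit : ∀ {n} → (Fin n → Fin n → ℚ) → ℚ → Tree n → List (Tree n) → Set
IsLargeSplit d R T ps =
  All IsTree ps ×
  All (IsSubtree T) ps ×
  (∀ (a b : Fin (length ps)) → a ≢ b →
     ∀ e → EdgeIn e (edges (lookup ps a)) → ¬ EdgeIn e (edges (lookup ps b))) ×
  (∀ e → e ∈ edges T → ∃ λ a → EdgeIn e (edges (lookup ps a))) ×
  (∀ v → v ∈ verts T → ∃ λ a → v ∈ verts (lookup ps a)) ×
  All (λ S → weight d S ≤ R + R + R + R) ps ×
  (∀ (a b : Fin (length ps)) → a ≢ b →
     (R + R ≤ weight d (lookup ps a)) ⊎ (R + R ≤ weight d (lookup ps b)))

IsContribution : ∀ {n} → (Fin n → Fin n → ℚ) → ℚ → Tree n → List (Tree n) → Set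
IsContribution d R T ps =
  (weight d T < R + R → ps ≡ T ∷ []) × (R + R ≤ weight d T → IsLargeSplit d R T ps)

module Submission where

-- Let W be the total weight of the trees T_C and m the number of components of G_R.  The trees
-- of 𝒯 coming from C are T_C itself or edge-disjoint subtrees of T_C, so they weigh at most W in
-- total.  Given a tree cover T̂_1, …, T̂_k of weight OPT, we show W + mR ≤ OPT + kR: walk through
-- each T̂_i in Prim order while keeping, inside every component of G_R, vertex-disjoint subtrees
-- of G_R ("blocks"), each charged its weight plus R.  An edge of length ≤ R reaching a new vertex
-- attaches it to the block of its other end, a longer edge opens a singleton block for R, so T̂_i
-- raises the total charge by at most w(T̂_i) + R.  Afterwards the blocks of a component are
-- joined along edges of G_R, which never raises the charge, into a spanning tree of the
-- component, whose charge is at least w(T_C) + R.  Summing ⌊(w + 2R)/2R⌋ ≤ (w + 2R)/2R over the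
-- components gives 2kR ≤ W + 2mR; adding twice the first bound yields W ≤ 2 OPT.

open import Defs
open import Data.Nat using (ℕ; _≤_)
open import Data.Fin using (Fin)
open import Data.Integer using (+_)
open import Data.Rational using (ℚ; 0ℚ; _+_; _<_)
open import Data.Rational using () renaming (_≤_ to _≤ℚ_)
open import Data.List using (List; length; concat; map; allFin)
open import Data.List.Membership.Propositional using (_∈_)
open import Data.Product using (∃)
open import Relation.Binary.PropositionalEquality using (_≡_; _≢_)
open import Relation.Nullary using (¬_)

open import Data.Nat as ℕ using (zero; suc; z≤n; s≤s)
import Data.Nat.Properties as ℕP
import Data.Nat.Coprimality as Coprimality
open import Data.Fin using (zero; suc)
import Data.Fin.Properties as FinP
open import Data.Integer as ℤ using (ℤ)
import Data.Integer.Properties as ℤP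
import Data.Integer.DivMod as ℤD
open import Data.Rational
  using (1ℚ; _*_; -_; _÷_; mkℚ; floor; ↥_; ↧_; *≤*; NonZero; NonNegative; positive; nonNegative)
open import Data.Rational.Properties
  using (≤-refl; ≤-reflexive; ≤-trans; <⇒≤; ≰⇒>; ≮⇒≥; _≤?_; _<?_; <-irrefl; ≤-<-trans;
         +-mono-<; +-mono-≤; +-monoˡ-≤; +-monoʳ-≤; +-identityˡ; +-identityʳ; +-assoc; +-comm;
         *-zeroˡ; *-zeroʳ; *-identityˡ; *-identityʳ; *-assoc; *-distribʳ-+; *-inverseˡ; *-monoʳ-≤-nonNeg;
         pos⇒nonZero; toℚᵘ-injective; toℚᵘ-homo-+; module ≤-Reasoning)
import Data.Rational.Unnormalised as ℚᵘ
import Data.Rational.Unnormalised.Properties as ℚᵘP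
open import Data.Rational.Solver using (module +-*-Solver)
open import Data.List using ([]; _∷_; [_]; _++_; foldr; lookup; tabulate)
open import Data.List.Properties using (length-++; length-removeAt′; concat-map; map-∘; map-tabulate)
open import Data.List.Membership.Propositional using (_∉_; _─_; find; lose)
open import Data.List.Membership.Propositional.Properties using (∈-++⁺ˡ; ∈-++⁺ʳ; ∈-++⁻; ∉[])
open import Data.List.Relation.Unary.Any using (Any; here; there; index; any?)
open import Data.List.Relation.Unary.Any.Properties using (lookup-index)
open import Data.List.Relation.Unary.All as All using (All; []; _∷_; all?)
open import Data.List.Relation.Unary.All.Properties using (¬All⇒Any¬; ¬Any⇒All¬)
import Data.List.Relation.Unary.All.Properties as AllP
open import Data.List.Relation.Unary.AllPairs using (AllPairs; []; _∷_)
open import Data.List.Relation.Unary.Unique.Propositional using (Unique)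
import Data.List.Relation.Unary.Unique.Propositional.Properties as UniqueP
open import Data.List.Relation.Binary.Disjoint.Propositional using (Disjoint)
open import Data.Product using (_×_; _,_; proj₁; proj₂; map₂)
open import Data.Sum as Sum using (_⊎_; inj₁; inj₂; [_,_]′)
open import Data.Empty using (⊥-elim)
open import Data.Vec.Functional using (updateAt)
open import Data.Vec.Functional.Properties using (updateAt-updates; updateAt-minimal)
open import Function using (_∘_; id; case_of_)
open import Function.Bundles using (Equivalence; mk⇔)
open import Relation.Nullary using (Dec; yes; no)
open import Relation.Unary using (Decidable)
open import Relation.Binary.PropositionalEquality
  using (refl; sym; trans; cong; cong₂; subst; subst₂; ≢-sym; module ≡-Reasoning)
open import Relation.Binary.Construct.Closure.ReflexiveTransitive using (Star; ε; _◅_)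

p≤p+q : ∀ p {q} → 0ℚ ≤ℚ q → p ≤ℚ p + q
p≤p+q p 0≤q = ≤-trans (≤-reflexive (sym (+-identityʳ p))) (+-monoʳ-≤ p 0≤q)

+-cancelʳ-≤ : ∀ r {p q} → p + r ≤ℚ q + r → p ≤ℚ q
+-cancelʳ-≤ r {p} {q} p+r≤q+r = begin
  p             ≡⟨ plus-minus p ⟩
  p + r + - r   ≤⟨ +-monoˡ-≤ (- r) p+r≤q+r ⟩
  q + r + - r   ≡⟨ sym (plus-minus q) ⟩
  q             ∎
  where
    open ≤-Reasoning
    plus-minus : ∀ x → x ≡ x + r + - r
    plus-minus x = solve 2 (λ x r → x := x :+ r :+ :- r) refl x r
      where open +-*-Solver

double-nonNeg⇒nonNeg : ∀ p → 0ℚ ≤ℚ p + p → 0ℚ ≤ℚ p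
double-nonNeg⇒nonNeg p 0≤2p with 0ℚ ≤? p
... | yes 0≤p = 0≤p
... | no  0≰p = ⊥-elim (<-irrefl refl (≤-<-trans 0≤2p (+-mono-< p<0 p<0)))
  where
    p<0 : p < 0ℚ
    p<0 = ≰⇒> 0≰p

≤-double : ∀ a b o r → a + b ≤ℚ o + r → r + r ≤ℚ a + (b + b) → a ≤ℚ o + o
≤-double a b o r a+b≤o+r 2r≤a+2b = +-cancelʳ-≤ (a + (b + b)) (begin
  a + (a + (b + b))         ≡⟨ solve 2 (λ a b → a :+ (a :+ (b :+ b)) := (a :+ b) :+ (a :+ b)) refl a b ⟩
  (a + b) + (a + b)         ≤⟨ +-mono-≤ a+b≤o+r a+b≤o+r ⟩
  (o + r) + (o + r)         ≡⟨ solve 2 (λ o r → (o :+ r) :+ (o :+ r) := (o :+ o) :+ (r :+ r)) refl o r ⟩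
  (o + o) + (r + r)         ≤⟨ +-monoʳ-≤ (o + o) 2r≤a+2b ⟩
  (o + o) + (a + (b + b))   ∎)
  where
    open ≤-Reasoning
    open +-*-Solver

fromℤ : ℤ → ℚ
fromℤ z = mkℚ z 0 (Coprimality.sym (Coprimality.1-coprimeTo _))

fromℤ-+ : ∀ a b → fromℤ (a ℤ.+ b) ≡ fromℤ a + fromℤ b
fromℤ-+ a b =
  toℚᵘ-injective (ℚᵘP.≃-sym (ℚᵘP.≃-trans (toℚᵘ-homo-+ (fromℤ a) (fromℤ b)) (ℚᵘ.*≡* cross)))
  where
    cross : (a ℤ.* + 1 ℤ.+ b ℤ.* + 1) ℤ.* + 1 ≡ (a ℤ.+ b) ℤ.* (+ 1 ℤ.* + 1)
    cross = trans (ℤP.*-identityʳ _)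
              (trans (cong₂ ℤ._+_ (ℤP.*-identityʳ a) (ℤP.*-identityʳ b)) (sym (ℤP.*-identityʳ _)))

fromℤ-floor-≤ : ∀ q → fromℤ (floor q) ≤ℚ q
fromℤ-floor-≤ q@record{} =
  *≤* (ℤP.≤-trans (ℤD.[n/d]*d≤n (↥ q) (↧ q)) (ℤP.≤-reflexive (sym (ℤP.*-identityʳ _))))

÷-*-cancel : ∀ p q .{{_ : NonZero q}} → (p ÷ q) * q ≡ p
÷-*-cancel p q = trans (*-assoc p _ q) (trans (cong (λ s → p * s) (*-inverseˡ q)) (*-identityʳ p))

sumFinℚ-mono : ∀ {k} {f g : Fin k → ℚ} → (∀ i → f i ≤ℚ g i) → sumFinℚ f ≤ℚ sumFinℚ g
sumFinℚ-mono {zero}  f≤g = ≤-refl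
sumFinℚ-mono {suc k} f≤g = +-mono-≤ (f≤g zero) (sumFinℚ-mono (f≤g ∘ suc))

sumFinℚ-+ : ∀ {k} (f g : Fin k → ℚ) → sumFinℚ (λ i → f i + g i) ≡ sumFinℚ f + sumFinℚ g
sumFinℚ-+ {zero}  f g = refl
sumFinℚ-+ {suc k} f g = trans (cong (λ s → f zero + g zero + s) (sumFinℚ-+ (f ∘ suc) (g ∘ suc)))
                              (interchange (f zero) (g zero) (sumFinℚ (f ∘ suc)) (sumFinℚ (g ∘ suc)))
  where
    interchange : ∀ a b c d → (a + b) + (c + d) ≡ (a + c) + (b + d)
    interchange = solve 4 (λ a b c d → (a :+ b) :+ (c :+ d) := (a :+ c) :+ (b :+ d)) refl
      where open +-*-Solver

sumFinℚ-*ʳ : ∀ {k} (f : Fin k → ℚ) x → sumFinℚ f * x ≡ sumFinℚ (λ i → f i * x)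
sumFinℚ-*ʳ {zero}  f x = *-zeroˡ x
sumFinℚ-*ʳ {suc k} f x = trans (*-distribʳ-+ x (f zero) (sumFinℚ (f ∘ suc)))
                               (cong (λ s → f zero * x + s) (sumFinℚ-*ʳ (f ∘ suc) x))

sumFinℚ-const : ∀ k x → sumFinℚ {k} (λ _ → x) ≡ fromℤ (+ k) * x
sumFinℚ-const zero    x = sym (*-zeroˡ x)
sumFinℚ-const (suc k) x = begin
  x + sumFinℚ {k} (λ _ → x)    ≡⟨ cong₂ _+_ (sym (*-identityˡ x)) (sumFinℚ-const k x) ⟩
  1ℚ * x + fromℤ (+ k) * x     ≡⟨ sym (*-distribʳ-+ x 1ℚ (fromℤ (+ k))) ⟩
  (1ℚ + fromℤ (+ k)) * x       ≡⟨ cong (_* x) (sym (fromℤ-+ (+ 1) (+ k))) ⟩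
  fromℤ (+ suc k) * x          ∎
  where open ≡-Reasoning

fromℤ-sumFinℤ : ∀ {k} (f : Fin k → ℤ) → fromℤ (sumFinℤ f) ≡ sumFinℚ (fromℤ ∘ f)
fromℤ-sumFinℤ {zero}  f = refl
fromℤ-sumFinℤ {suc k} f = trans (fromℤ-+ (f zero) (sumFinℤ (f ∘ suc)))
                                (cong (λ s → fromℤ (f zero) + s) (fromℤ-sumFinℤ (f ∘ suc)))

sumℚ-++ : ∀ xs ys → sumℚ (xs ++ ys) ≡ sumℚ xs + sumℚ ys
sumℚ-++ []       ys = sym (+-identityˡ (sumℚ ys))
sumℚ-++ (x ∷ xs) ys = trans (cong (λ s → x + s) (sumℚ-++ xs ys)) (sym (+-assoc x (sumℚ xs) (sumℚ ys)))

sumℚ-concat-tabulate : ∀ {k} (f : Fin k → List ℚ) → sumℚ (concat (tabulate f)) ≡ sumFinℚ (sumℚ ∘ f)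
sumℚ-concat-tabulate {zero}  f = refl
sumℚ-concat-tabulate {suc k} f = trans (sumℚ-++ (f zero) (concat (tabulate (f ∘ suc))))
                                       (cong (λ s → sumℚ (f zero) + s) (sumℚ-concat-tabulate (f ∘ suc)))

sumℚ-map-concat-allFin : ∀ {A : Set} {k} (w : A → ℚ) (P : Fin k → List A) →
                         sumℚ (map w (concat (map P (allFin k)))) ≡ sumFinℚ (λ i → sumℚ (map w (P i)))
sumℚ-map-concat-allFin {k = k} w P = begin
  sumℚ (map w (concat (map P (allFin k))))        ≡⟨ cong sumℚ (concat-map (map P (allFin k))) ⟨
  sumℚ (concat (map (map w) (map P (allFin k))))  ≡⟨ cong (sumℚ ∘ concat) (map-∘ (allFin k)) ⟨
  sumℚ (concat (map (map w ∘ P) (allFin k)))      ≡⟨ cong (sumℚ ∘ concat) (map-tabulate id (map w ∘ P)) ⟩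
  sumℚ (concat (tabulate (map w ∘ P)))            ≡⟨ sumℚ-concat-tabulate (map w ∘ P) ⟩
  sumFinℚ (λ i → sumℚ (map w (P i)))              ∎
  where open ≡-Reasoning

sumFinℚ-updateAt-≤ : ∀ {A : Set} {k} (h : A → ℚ) (xs : Fin k → A) i {y δ} → h y ≤ℚ h (xs i) + δ →
                     sumFinℚ (h ∘ updateAt xs i (λ _ → y)) ≤ℚ sumFinℚ (h ∘ xs) + δ
sumFinℚ-updateAt-≤ h xs zero {y} {δ} hy≤ = begin
  h y + sumFinℚ (h ∘ xs ∘ suc)              ≤⟨ +-monoˡ-≤ (sumFinℚ (h ∘ xs ∘ suc)) hy≤ ⟩
  h (xs zero) + δ + sumFinℚ (h ∘ xs ∘ suc)  ≡⟨ solve 3 (λ a b c → a :+ b :+ c := a :+ c :+ b) refl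
                                                       (h (xs zero)) δ (sumFinℚ (h ∘ xs ∘ suc)) ⟩
  h (xs zero) + sumFinℚ (h ∘ xs ∘ suc) + δ  ∎
  where
    open ≤-Reasoning
    open +-*-Solver
sumFinℚ-updateAt-≤ h xs (suc i) {y} {δ} hy≤ = begin
  h (xs zero) + sumFinℚ (h ∘ updateAt (xs ∘ suc) i (λ _ → y))
    ≤⟨ +-monoʳ-≤ (h (xs zero)) (sumFinℚ-updateAt-≤ h (xs ∘ suc) i hy≤) ⟩
  h (xs zero) + (sumFinℚ (h ∘ xs ∘ suc) + δ)
    ≡⟨ +-assoc (h (xs zero)) (sumFinℚ (h ∘ xs ∘ suc)) δ ⟨
  h (xs zero) + sumFinℚ (h ∘ xs ∘ suc) + δ
    ∎
  where open ≤-Reasoning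

allot-bound : ∀ R (R>0 : 0ℚ < R) w → fromℤ (allot R R>0 w) * (R + R) ≤ℚ w + (R + R)
allot-bound R R>0 w = begin
  fromℤ (floor q) * (R + R)   ≤⟨ *-monoʳ-≤-nonNeg (R + R) (fromℤ-floor-≤ q) ⟩
  q * (R + R)                 ≡⟨ ÷-*-cancel (w + (R + R)) (R + R) ⟩
  w + (R + R)                 ∎
  where
    open ≤-Reasoning
    instance
      2R-nonZero : NonZero (R + R)
      2R-nonZero = pos⇒nonZero (R + R) {{positive (twoPos R>0)}}
      2R-nonNeg : NonNegative (R + R)
      2R-nonNeg = nonNegative (<⇒≤ (twoPos R>0))
    q : ℚ
    q = (w + (R + R)) ÷ (R + R)

allot-sum-bound : ∀ R (R>0 : 0ℚ < R) {m} (w : Fin m → ℚ) k → sumFinℤ (λ c → allot R R>0 (w c)) ≡ + k →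
                  sumFinℚ {k} (λ _ → R + R) ≤ℚ sumFinℚ (λ c → w c + (R + R))
allot-sum-bound R R>0 {m} w k Σallot≡k = begin
  sumFinℚ {k} (λ _ → R + R)                ≡⟨ sumFinℚ-const k (R + R) ⟩
  fromℤ (+ k) * (R + R)                    ≡⟨ cong (λ z → fromℤ z * (R + R)) (sym Σallot≡k) ⟩
  fromℤ (sumFinℤ a) * (R + R)              ≡⟨ cong (_* (R + R)) (fromℤ-sumFinℤ a) ⟩
  sumFinℚ (fromℤ ∘ a) * (R + R)            ≡⟨ sumFinℚ-*ʳ (fromℤ ∘ a) (R + R) ⟩
  sumFinℚ (λ c → fromℤ (a c) * (R + R))    ≤⟨ sumFinℚ-mono (λ c → allot-bound R R>0 (w c)) ⟩
  sumFinℚ (λ c → w c + (R + R))            ∎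
  where
    open ≤-Reasoning
    a : Fin m → ℤ
    a c = allot R R>0 (w c)

module _ {A : Set} where

  ∈-─⁺ : ∀ {x y} {xs : List A} (x∈xs : x ∈ xs) → y ∈ xs → y ≢ x → y ∈ xs ─ x∈xs
  ∈-─⁺ (here refl) (here refl) y≢x = ⊥-elim (y≢x refl)
  ∈-─⁺ (here _)    (there y∈)  _   = y∈
  ∈-─⁺ (there _)   (here y≡)   _   = here y≡
  ∈-─⁺ (there x∈)  (there y∈)  y≢x = there (∈-─⁺ x∈ y∈ y≢x)

  Unique-⊆⇒length≤ : ∀ {xs ys : List A} → Unique xs → (∀ {x} → x ∈ xs → x ∈ ys) →
                     length xs ≤ length ys
  Unique-⊆⇒length≤ {[]}     _            _   = z≤n
  Unique-⊆⇒length≤ {x ∷ xs} {ys} (x∉xs ∷ u) xs⊆ys = ℕP.≤-trans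
    (s≤s (Unique-⊆⇒length≤ u λ z∈xs →
            ∈-─⁺ x∈ys (xs⊆ys (there z∈xs)) (≢-sym (All.lookup x∉xs z∈xs))))
    (ℕP.≤-reflexive (sym (length-removeAt′ ys (index x∈ys))))
    where
      x∈ys : x ∈ ys
      x∈ys = xs⊆ys (here refl)

  Disjoint-++ʳ : ∀ {xs ys zs : List A} → Disjoint xs ys → Disjoint xs zs → Disjoint xs (ys ++ zs)
  Disjoint-++ʳ {ys = ys} xs#ys xs#zs (v∈xs , v∈ys++zs) =
    [ (λ v∈ys → xs#ys (v∈xs , v∈ys)) , (λ v∈zs → xs#zs (v∈xs , v∈zs)) ]′ (∈-++⁻ ys v∈ys++zs)

  ≢[]⇒∃∈ : ∀ (xs : List A) → xs ≢ [] → ∃ (_∈ xs)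
  ≢[]⇒∃∈ []      xs≢[] = ⊥-elim (xs≢[] refl)
  ≢[]⇒∃∈ (x ∷ _) _     = x , here refl

  record Crossing (_⟶_ : A → A → Set) (P : A → Set) : Set where
    constructor crossing
    field
      from to : A
      link    : from ⟶ to
      from-in : P from
      to-out  : ¬ P to

  Star-crossing : ∀ {_⟶_ : A → A → Set} {P : A → Set} → Decidable P → ∀ {x y} →
                  Star _⟶_ x y → P x → ¬ P y → Crossing _⟶_ P
  Star-crossing P? ε                      Px ¬Py = ⊥-elim (¬Py Px)
  Star-crossing P? (_◅_ {j = w} x⟶w w⟶⋆y) Px ¬Py with P? w
  ... | yes Pw = Star-crossing P? w⟶⋆y Pw ¬Py
  ... | no ¬Pw = crossing _ w x⟶w Px ¬Pw

Conn-map : ∀ {n} {E E′ : List (Edge n)} → (∀ {x y} → EdgeIn (x , y) E → EdgeIn (x , y) E′) →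
           ∀ {u v} → Conn E u v → Conn E′ u v
Conn-map E⊆E′ here           = here
Conn-map E⊆E′ (step uw w⟶⋆v) = step (E⊆E′ uw) (Conn-map E⊆E′ w⟶⋆v)

Conn-trans : ∀ {n} {E : List (Edge n)} {u w v} → Conn E u w → Conn E w v → Conn E u v
Conn-trans here           w⟶⋆v = w⟶⋆v
Conn-trans (step uw u⟶⋆w) w⟶⋆v = step uw (Conn-trans u⟶⋆w w⟶⋆v)

join : ∀ {n} → Tree n → Tree n → Fin n → Fin n → Tree n
join Z X z x = mkTree (verts Z ++ verts X) ((z , x) ∷ edges Z ++ edges X)

root : ∀ {n} {T : Tree n} → IsTree T → ∃ (_∈ verts T)
root {T = T} T-tree = ≢[]⇒∃∈ (verts T) (IsTree.nonempty T-tree)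

join-connected : ∀ {n} {Z X : Tree n} {z x} → IsTree Z → IsTree X → z ∈ verts Z → x ∈ verts X →
                 ∀ u v → u ∈ verts (join Z X z x) → v ∈ verts (join Z X z x) → Conn (edges (join Z X z x)) u v
join-connected {n} {Z} {X} {z} {x} Z-tree X-tree z∈Z x∈X u v u∈ v∈ =
  walk (∈-++⁻ (verts Z) u∈) (∈-++⁻ (verts Z) v∈)
  where
    E : List (Edge n)
    E = edges (join Z X z x)
    inZ : ∀ {u v} → u ∈ verts Z → v ∈ verts Z → Conn E u v
    inZ u∈Z v∈Z = Conn-map (Sum.map (there ∘ ∈-++⁺ˡ) (there ∘ ∈-++⁺ˡ))
                           (IsTree.connected Z-tree _ _ u∈Z v∈Z)
    inX : ∀ {u v} → u ∈ verts X → v ∈ verts X → Conn E u v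
    inX u∈X v∈X = Conn-map (Sum.map (there ∘ ∈-++⁺ʳ (edges Z)) (there ∘ ∈-++⁺ʳ (edges Z)))
                           (IsTree.connected X-tree _ _ u∈X v∈X)
    walk : u ∈ verts Z ⊎ u ∈ verts X → v ∈ verts Z ⊎ v ∈ verts X → Conn E u v
    walk (inj₁ u∈Z) (inj₁ v∈Z) = inZ u∈Z v∈Z
    walk (inj₁ u∈Z) (inj₂ v∈X) = Conn-trans (inZ u∈Z z∈Z) (step (inj₁ (here refl)) (inX x∈X v∈X))
    walk (inj₂ u∈X) (inj₁ v∈Z) = Conn-trans (inX u∈X x∈X) (step (inj₂ (here refl)) (inZ z∈Z v∈Z))
    walk (inj₂ u∈X) (inj₂ v∈X) = inX u∈X v∈X

join-isTree : ∀ {n} {Z X : Tree n} {z x} → IsTree Z → IsTree X → z ∈ verts Z → x ∈ verts X →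
              Disjoint (verts Z) (verts X) → IsTree (join Z X z x)
join-isTree {Z = Z} {X} {z} {x} Z-tree X-tree z∈Z x∈X Z#X = record
  { nonempty  = λ ZX≡[] → ∉[] (subst (z ∈_) ZX≡[] (∈-++⁺ˡ z∈Z))
  ; distinct  = UniqueP.++⁺ Z.distinct X.distinct Z#X
  ; endpoints = (∈-++⁺ˡ z∈Z , ∈-++⁺ʳ (verts Z) x∈X)
                ∷ AllP.++⁺ (All.map (λ (p , q) → ∈-++⁺ˡ p , ∈-++⁺ˡ q) Z.endpoints)
                           (All.map (λ (p , q) → ∈-++⁺ʳ (verts Z) p , ∈-++⁺ʳ (verts Z) q) X.endpoints)
  ; connected = join-connected Z-tree X-tree z∈Z x∈X
  ; edgeCount = begin
      suc (suc (length (edges Z ++ edges X)))            ≡⟨ cong (λ k → suc (suc k)) (length-++ (edges Z)) ⟩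
      suc (suc (length (edges Z) ℕ.+ length (edges X)))  ≡⟨ cong suc (ℕP.+-suc (length (edges Z)) _) ⟨
      suc (length (edges Z)) ℕ.+ suc (length (edges X))  ≡⟨ cong₂ ℕ._+_ Z.edgeCount X.edgeCount ⟩
      length (verts Z) ℕ.+ length (verts X)              ≡⟨ length-++ (verts Z) ⟨
      length (verts Z ++ verts X)                        ∎
  }
  where
    module Z = IsTree Z-tree
    module X = IsTree X-tree
    open ≡-Reasoning

metric-nonNeg : ∀ {n} {d : Fin n → Fin n → ℚ} → IsMetric d → ∀ x y → 0ℚ ≤ℚ d x y
metric-nonNeg {d = d} metric x y = double-nonNeg⇒nonNeg (d x y)
  (subst₂ _≤ℚ_ (Equivalence.from (zero-iff x x) refl) (cong (λ s → d x y + s) (symm y x)) (triangle x y x))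
  where open IsMetric metric

module WeightedGraph {n : ℕ} (d : Fin n → Fin n → ℚ)
                     (d-sym : ∀ x y → d x y ≡ d y x) (d-nonNeg : ∀ x y → 0ℚ ≤ℚ d x y) where

  open import Data.List.Membership.DecPropositional (FinP._≟_ {n}) using (_∈?_)

  V : Set
  V = Fin n

  -- Defined like weight, so that weight d T reduces to edgeWeight (edges T).
  edgeWeight : List (Edge n) → ℚ
  edgeWeight = foldr (λ e acc → d (proj₁ e) (proj₂ e) + acc) 0ℚ

  edgeWeight-nonNeg : ∀ E → 0ℚ ≤ℚ edgeWeight E
  edgeWeight-nonNeg []            = ≤-refl
  edgeWeight-nonNeg ((a , b) ∷ E) = +-mono-≤ (d-nonNeg a b) (edgeWeight-nonNeg E)

  edgeWeight-++ : ∀ E F → edgeWeight (E ++ F) ≡ edgeWeight E + edgeWeight F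
  edgeWeight-++ []            F = sym (+-identityˡ (edgeWeight F))
  edgeWeight-++ ((a , b) ∷ E) F = trans (cong (λ s → d a b + s) (edgeWeight-++ E F)) (sym (+-assoc (d a b) _ _))

  edgeWeight-─ : ∀ {a b} E (ab∈E : (a , b) ∈ E) → edgeWeight E ≡ d a b + edgeWeight (E ─ ab∈E)
  edgeWeight-─ (_ ∷ E)       (here refl)  = refl
  edgeWeight-─ {a} {b} ((x , y) ∷ E) (there ab∈E) = begin
    d x y + edgeWeight E                    ≡⟨ cong (λ s → d x y + s) (edgeWeight-─ E ab∈E) ⟩
    d x y + (d a b + edgeWeight (E ─ ab∈E))  ≡⟨ solve 3 (λ p q r → p :+ (q :+ r) := q :+ (p :+ r)) refl
                                                      (d x y) (d a b) (edgeWeight (E ─ ab∈E)) ⟩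
    d a b + (d x y + edgeWeight (E ─ ab∈E))  ∎
    where
      open ≡-Reasoning
      open +-*-Solver

  _⊆ᴱ_ : List (Edge n) → List (Edge n) → Set
  L ⊆ᴱ E = ∀ {u v} → (u , v) ∈ L → EdgeIn (u , v) E

  EdgeIn-swap : ∀ {u v : V} {E : List (Edge n)} → EdgeIn (u , v) E → EdgeIn (v , u) E
  EdgeIn-swap (inj₁ uv∈E) = inj₂ uv∈E
  EdgeIn-swap (inj₂ vu∈E) = inj₁ vu∈E

  EdgeIn-⊆ᴱ : ∀ {L E : List (Edge n)} {u v : V} → L ⊆ᴱ E → EdgeIn (u , v) L → EdgeIn (u , v) E
  EdgeIn-⊆ᴱ L⊆E (inj₁ uv∈L) = L⊆E uv∈L
  EdgeIn-⊆ᴱ L⊆E (inj₂ vu∈L) = EdgeIn-swap (L⊆E vu∈L)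

  swap-≡ : ∀ {u v a b : V} → (v , u) ≡ (a , b) → (u , v) ≡ (b , a)
  swap-≡ refl = refl

  record EdgeRemoval (E : List (Edge n)) (a b : V) : Set where
    field
      rest         : List (Edge n)
      weight-split : edgeWeight E ≡ d a b + edgeWeight rest
      length-split : length E ≡ suc (length rest)
      keeps        : ∀ {u v} → EdgeIn (u , v) E → (u , v) ≢ (a , b) → (u , v) ≢ (b , a) → EdgeIn (u , v) rest

  removeEdge : ∀ {a b} E → EdgeIn (a , b) E → EdgeRemoval E a b
  removeEdge E (inj₁ ab∈E) = record
    { rest         = E ─ ab∈E
    ; weight-split = edgeWeight-─ E ab∈E
    ; length-split = length-removeAt′ E (index ab∈E)
    ; keeps        = λ { (inj₁ uv∈E) ≢ab _ → inj₁ (∈-─⁺ ab∈E uv∈E ≢ab)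
                       ; (inj₂ vu∈E) _ ≢ba → inj₂ (∈-─⁺ ab∈E vu∈E (≢ba ∘ swap-≡)) } }
  removeEdge {a} {b} E (inj₂ ba∈E) = record
    { rest         = E ─ ba∈E
    ; weight-split = trans (edgeWeight-─ E ba∈E) (cong (_+ edgeWeight (E ─ ba∈E)) (d-sym b a))
    ; length-split = length-removeAt′ E (index ba∈E)
    ; keeps        = λ { (inj₁ uv∈E) _ ≢ba → inj₁ (∈-─⁺ ba∈E uv∈E ≢ba)
                       ; (inj₂ vu∈E) ≢ab _ → inj₂ (∈-─⁺ ba∈E vu∈E (≢ab ∘ swap-≡)) } }

  EdgeIn-there : ∀ {e} {u v : V} {E : List (Edge n)} → EdgeIn (u , v) E → EdgeIn (u , v) (e ∷ E)
  EdgeIn-there (inj₁ uv∈E) = inj₁ (there uv∈E)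
  EdgeIn-there (inj₂ vu∈E) = inj₂ (there vu∈E)

  data EdgeUnique : List (Edge n) → Set where
    []  : EdgeUnique []
    _∷_ : ∀ {e L} → ¬ EdgeIn e L → EdgeUnique L → EdgeUnique (e ∷ L)

  record Complement (L E : List (Edge n)) : Set where
    field
      rest         : List (Edge n)
      weight-split : edgeWeight E ≡ edgeWeight L + edgeWeight rest
      keeps        : ∀ {u v} → EdgeIn (u , v) E → ¬ EdgeIn (u , v) L → EdgeIn (u , v) rest

  complement : ∀ {L E} → EdgeUnique L → L ⊆ᴱ E → Complement L E
  complement {[]} {E} [] _ = record
    { rest = E ; weight-split = sym (+-identityˡ (edgeWeight E)) ; keeps = λ uv∈E _ → uv∈E }
  complement {(a , b) ∷ L} {E} (ab∉L ∷ L-unique) abL⊆E = record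
    { rest         = C.rest
    ; weight-split = begin
        edgeWeight E                              ≡⟨ R.weight-split ⟩
        d a b + edgeWeight R.rest                 ≡⟨ cong (λ s → d a b + s) C.weight-split ⟩
        d a b + (edgeWeight L + edgeWeight C.rest) ≡⟨ sym (+-assoc (d a b) _ _) ⟩
        d a b + edgeWeight L + edgeWeight C.rest   ∎
    ; keeps        = λ uv∈E uv∉abL → C.keeps (R.keeps uv∈E (λ { refl → uv∉abL (inj₁ (here refl)) })
                                                           (λ { refl → uv∉abL (inj₂ (here refl)) }))
                                             (uv∉abL ∘ EdgeIn-there)
    }
    where
      open ≡-Reasoning
      module R = EdgeRemoval (removeEdge E (abL⊆E (here refl)))
      L⊆R : L ⊆ᴱ R.rest
      L⊆R uv∈L = R.keeps (abL⊆E (there uv∈L)) (λ { refl → ab∉L (inj₁ uv∈L) })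
                                                (λ { refl → ab∉L (inj₂ uv∈L) })
      module C = Complement (complement L-unique L⊆R)

  data PrimOrder (E : List (Edge n)) : List V → List (Edge n) → List V → Set where
    done   : ∀ {vis} → PrimOrder E vis [] vis
    extend : ∀ {vis a b st fin} → a ∈ vis → b ∉ vis → EdgeIn (a , b) E →
             PrimOrder E (b ∷ vis) st fin → PrimOrder E vis ((a , b) ∷ st) fin

  module _ {E : List (Edge n)} where

    PrimOrder-length : ∀ {vis st fin} → PrimOrder E vis st fin → length fin ≡ length st ℕ.+ length vis
    PrimOrder-length done = refl
    PrimOrder-length (extend {vis = vis} {st = st} _ _ _ po) =
      trans (PrimOrder-length po) (ℕP.+-suc (length st) (length vis))

    PrimOrder-unique : ∀ {vis st fin} → Unique vis → PrimOrder E vis st fin → Unique fin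
    PrimOrder-unique vis-unique done                   = vis-unique
    PrimOrder-unique vis-unique (extend _ b∉vis _ po) = PrimOrder-unique (¬Any⇒All¬ _ b∉vis ∷ vis-unique) po

    PrimOrder-⊆ : ∀ {U vis st fin} → (∀ {v} → v ∈ vis → v ∈ U) →
                  All (λ e → (proj₁ e ∈ U) × (proj₂ e ∈ U)) E →
                  PrimOrder E vis st fin → ∀ {v} → v ∈ fin → v ∈ U
    PrimOrder-⊆ vis⊆U _     done = vis⊆U
    PrimOrder-⊆ {U} vis⊆U E⊆U² (extend _ _ ab∈E po) =
      PrimOrder-⊆ (λ { (here refl) → b∈U ab∈E ; (there v∈) → vis⊆U v∈ }) E⊆U² po
      where
        b∈U : ∀ {a b} → EdgeIn (a , b) E → b ∈ U
        b∈U (inj₁ ab∈E) = proj₂ (All.lookup E⊆U² ab∈E)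
        b∈U (inj₂ ba∈E) = proj₁ (All.lookup E⊆U² ba∈E)

    PrimOrder-⊆ᴱ : ∀ {vis st fin} → PrimOrder E vis st fin → st ⊆ᴱ E
    PrimOrder-⊆ᴱ (extend _ _ ab∈E _) (here refl) = ab∈E
    PrimOrder-⊆ᴱ (extend _ _ _ po)   (there uv∈) = PrimOrder-⊆ᴱ po uv∈

    PrimOrder-fresh : ∀ {vis st fin} → PrimOrder E vis st fin → ∀ {u v} → (u , v) ∈ st → v ∉ vis
    PrimOrder-fresh (extend _ b∉vis _ _) (here refl) = b∉vis
    PrimOrder-fresh (extend _ _ _ po)    (there uv∈) = PrimOrder-fresh po uv∈ ∘ there

    PrimOrder-edgeUnique : ∀ {vis st fin} → PrimOrder E vis st fin → EdgeUnique st
    PrimOrder-edgeUnique done = []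
    PrimOrder-edgeUnique (extend a∈vis _ _ po) =
      (λ { (inj₁ ab∈st) → PrimOrder-fresh po ab∈st (here refl)
         ; (inj₂ ba∈st) → PrimOrder-fresh po ba∈st (there a∈vis) })
      ∷ PrimOrder-edgeUnique po

    Conn⇒Star : ∀ {u v} → Conn E u v → Star (λ x y → EdgeIn (x , y) E) u v
    Conn⇒Star here              = ε
    Conn⇒Star (step uw∈E w⟶⋆v) = uw∈E ◅ Conn⇒Star w⟶⋆v

    EdgeIn⇒nonempty : ∀ {a b} {L : List (Edge n)} → EdgeIn (a , b) L → length L ≢ 0
    EdgeIn⇒nonempty {L = []}    (inj₁ ())
    EdgeIn⇒nonempty {L = []}    (inj₂ ())
    EdgeIn⇒nonempty {L = _ ∷ _} _ ()

    record PrimRun (U vis : List V) (Erem : List (Edge n)) : Set where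
      field
        order        : List (Edge n)
        fin          : List V
        isOrder      : PrimOrder E vis order fin
        spans        : ∀ {u} → u ∈ U → u ∈ fin
        unused       : List (Edge n)
        weight-split : edgeWeight Erem ≡ edgeWeight order + edgeWeight unused
        length-split : length Erem ≡ length order ℕ.+ length unused

    -- Invariant: every edge of E towards an unvisited vertex is still in Erem, so the edge by which
    -- a walk from r leaves vis can be taken out of Erem; the fuel is the length of Erem.
    primRun : ∀ {r} U → (∀ {u} → u ∈ U → Conn E r u) →
              ∀ fuel vis Erem → length Erem ≡ fuel → r ∈ vis →
              (∀ {x y} → EdgeIn (x , y) E → y ∉ vis → EdgeIn (x , y) Erem) → PrimRun U vis Erem
    primRun U reach fuel vis Erem |Erem|≡fuel r∈vis available with all? (_∈? vis) U
    ... | yes U⊆vis = record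
      { order = [] ; fin = vis ; isOrder = done ; spans = All.lookup U⊆vis ; unused = Erem
      ; weight-split = sym (+-identityˡ (edgeWeight Erem)) ; length-split = refl }
    ... | no U⊈vis with find (¬All⇒Any¬ (_∈? vis) U U⊈vis)
    ... | u , u∈U , u∉vis with Star-crossing (_∈? vis) (Conn⇒Star (reach u∈U)) r∈vis u∉vis
    ... | crossing a b ab∈E a∈vis b∉vis with fuel | available ab∈E b∉vis
    ...   | zero     | ab∈Erem = ⊥-elim (EdgeIn⇒nonempty ab∈Erem |Erem|≡fuel)
    ...   | suc fuel | ab∈Erem = record
      { order        = (a , b) ∷ P.order
      ; fin          = P.fin
      ; isOrder      = extend a∈vis b∉vis ab∈E P.isOrder
      ; spans        = P.spans
      ; unused       = P.unused
      ; weight-split = trans R.weight-split (trans (cong (λ s → d a b + s) P.weight-split)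
                                                   (sym (+-assoc (d a b) _ _)))
      ; length-split = trans R.length-split (cong suc P.length-split)
      }
      where
        module R = EdgeRemoval (removeEdge Erem ab∈Erem)
        available′ : ∀ {x y} → EdgeIn (x , y) E → y ∉ b ∷ vis → EdgeIn (x , y) R.rest
        available′ xy∈E y∉b∷vis = R.keeps (available xy∈E (y∉b∷vis ∘ there))
                                          (λ { refl → y∉b∷vis (here refl) }) (λ { refl → y∉b∷vis (there a∈vis) })
        module P = PrimRun (primRun U reach fuel (b ∷ vis) R.rest
                             (ℕP.suc-injective (trans (sym R.length-split) |Erem|≡fuel)) (there r∈vis) available′)

  record SpanningOrder (T : Tree n) (r : V) : Set where
    field
      order   : List (Edge n)
      fin     : List V
      isOrder : PrimOrder (edges T) [ r ] order fin
      spans   : ∀ {v} → v ∈ verts T → v ∈ fin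
      weight≡ : weight d T ≡ edgeWeight order

  -- The order has |verts T| − 1 = |edges T| edges, so it uses up every edge of T.
  spanningOrder : ∀ {T r} → IsTree T → r ∈ verts T → SpanningOrder T r
  spanningOrder {T} {r} T-tree r∈T = record
    { order = P.order ; fin = P.fin ; isOrder = P.isOrder ; spans = P.spans
    ; weight≡ = trans P.weight-split (trans (cong (λ E → edgeWeight P.order + edgeWeight E) unused≡[])
                                             (+-identityʳ (edgeWeight P.order))) }
    where
      module T = IsTree T-tree
      module P = PrimRun (primRun (verts T) (T.connected r _ r∈T) (length (edges T)) [ r ] (edges T)
                                  refl (here refl) (λ uv∈T _ → uv∈T))
      |fin|≡|T| : length P.fin ≡ length (verts T)
      |fin|≡|T| = ℕP.≤-antisym
        (Unique-⊆⇒length≤ (PrimOrder-unique ([] ∷ []) P.isOrder)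
                          (PrimOrder-⊆ (λ { (here refl) → r∈T }) T.endpoints P.isOrder))
        (Unique-⊆⇒length≤ T.distinct P.spans)
      counting : suc (length P.order ℕ.+ length P.unused) ≡ suc (length P.order ℕ.+ 0)
      counting = begin
        suc (length P.order ℕ.+ length P.unused)  ≡⟨ cong suc P.length-split ⟨
        suc (length (edges T))                     ≡⟨ T.edgeCount ⟩
        length (verts T)                           ≡⟨ |fin|≡|T| ⟨
        length P.fin                               ≡⟨ PrimOrder-length P.isOrder ⟩
        length P.order ℕ.+ 1                       ≡⟨ ℕP.+-suc (length P.order) 0 ⟩
        suc (length P.order ℕ.+ 0)                 ∎
        where open ≡-Reasoning
      unused≡[] : P.unused ≡ []
      unused≡[] with P.unused | ℕP.+-cancelˡ-≡ (length P.order) _ _ (ℕP.suc-injective counting)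
      ... | [] | _ = refl

  EdgeDisjointFamily : List (Tree n) → Set
  EdgeDisjointFamily ps = ∀ (a b : Fin (length ps)) → a ≢ b →
                          ∀ e → EdgeIn e (edges (lookup ps a)) → ¬ EdgeIn e (edges (lookup ps b))

  pieces-weight-≤ : ∀ {E} ps → All IsTree ps → EdgeDisjointFamily ps → All (λ S → edges S ⊆ᴱ E) ps →
                    sumℚ (map (weight d) ps) ≤ℚ edgeWeight E
  pieces-weight-≤ {E} []       _                   _        _             = edgeWeight-nonNeg E
  pieces-weight-≤ {E} (S ∷ ps) (S-tree ∷ ps-trees) disjoint (S⊆E ∷ ps⊆E) = begin
    weight d S + sumℚ (map (weight d) ps)  ≤⟨ +-mono-≤ (≤-reflexive O.weight≡)
                                                        (pieces-weight-≤ ps ps-trees disjoint-tail ps⊆rest) ⟩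
    edgeWeight O.order + edgeWeight C.rest ≡⟨ C.weight-split ⟨
    edgeWeight E                           ∎
    where
      open ≤-Reasoning
      module O = SpanningOrder (spanningOrder S-tree (proj₂ (root S-tree)))
      order⊆S : O.order ⊆ᴱ edges S
      order⊆S = PrimOrder-⊆ᴱ O.isOrder
      module C = Complement (complement (PrimOrder-edgeUnique O.isOrder) (EdgeIn-⊆ᴱ S⊆E ∘ order⊆S))
      disjoint-tail : EdgeDisjointFamily ps
      disjoint-tail a b a≢b = disjoint (suc a) (suc b) (a≢b ∘ FinP.suc-injective)
      Apart : Tree n → Set
      Apart S′ = ∀ {u v} → EdgeIn (u , v) (edges S′) → ¬ EdgeIn (u , v) (edges S)
      apart : All Apart ps
      apart = All.tabulate λ S′∈ps →
        subst Apart (sym (lookup-index S′∈ps)) (λ {u} {v} → disjoint (suc (index S′∈ps)) zero (λ ()) (u , v))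
      ps⊆rest : All (λ S′ → edges S′ ⊆ᴱ C.rest) ps
      ps⊆rest = All.zipWith (λ (S′⊆E , S′-apart) {_} {_} uv∈S′ →
                               C.keeps (S′⊆E uv∈S′) (S′-apart (inj₁ uv∈S′) ∘ EdgeIn-⊆ᴱ order⊆S))
                            (ps⊆E , apart)

  contribution-≤ : ∀ {R T ps} → IsContribution d R T ps → sumℚ (map (weight d) ps) ≤ℚ weight d T
  contribution-≤ {R} {T} (small⇒single , large⇒split) with weight d T <? R + R
  ... | yes small rewrite small⇒single small = ≤-reflexive (+-identityʳ (weight d T))
  ... | no  large with large⇒split (≮⇒≥ large)
  ...   | trees , subtrees , disjoint , _ =
    pieces-weight-≤ _ trees disjoint (All.map (λ (_ , S⊆T) {_} {_} → All.lookup S⊆T) subtrees)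

module Forest {n : ℕ} (d : Fin n → Fin n → ℚ)
              (d-sym : ∀ x y → d x y ≡ d y x) (d-nonNeg : ∀ x y → 0ℚ ≤ℚ d x y)
              (R : ℚ) (R-nonNeg : 0ℚ ≤ℚ R)
              {m : ℕ} (C : Fin m → List (Fin n))
              (C-component : ∀ c → IsComponent d R (C c))
              (C-disjoint : ∀ c c′ → c ≢ c′ → ∀ v → v ∈ C c → ¬ (v ∈ C c′))
              (C-cover : ∀ v → ∃ λ c → v ∈ C c) where

  open WeightedGraph d d-sym d-nonNeg
  open import Data.List.Membership.DecPropositional (FinP._≟_ {n}) using (_∈?_)

  comp : V → Fin m
  comp v = proj₁ (C-cover v)

  ∈-comp : ∀ v → v ∈ C (comp v)
  ∈-comp v = proj₂ (C-cover v)

  comp-unique : ∀ {v c} → v ∈ C c → c ≡ comp v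
  comp-unique {v} {c} v∈C with c FinP.≟ comp v
  ... | yes c≡ = c≡
  ... | no  c≢ = ⊥-elim (C-disjoint c (comp v) c≢ v v∈C (∈-comp v))

  comp-short : ∀ {u v} → d u v ≤ℚ R → comp u ≡ comp v
  comp-short {u} {v} short = comp-unique (IsComponent.closed (C-component (comp u)) u v (∈-comp u) short)

  record Block (c : Fin m) (X : Tree n) : Set where
    field
      isTree : IsTree X
      short  : All (λ e → d (proj₁ e) (proj₂ e) ≤ℚ R) (edges X)
      inside : ∀ {v} → v ∈ verts X → v ∈ C c

  Blocks : Fin m → List (Tree n) → Set
  Blocks c L = All (Block c) L × AllPairs (λ X Y → Disjoint (verts X) (verts Y)) L

  infix 4 _∈ᴮ_
  _∈ᴮ_ : V → List (Tree n) → Set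
  v ∈ᴮ L = Any (λ X → v ∈ verts X) L

  ∈ᴮ-inside : ∀ {c L v} → Blocks c L → v ∈ᴮ L → v ∈ C c
  ∈ᴮ-inside (L-blocks , _) v∈L with find v∈L
  ... | X , X∈L , v∈X = Block.inside (All.lookup L-blocks X∈L) v∈X

  cost : Tree n → ℚ
  cost X = weight d X + R

  Φ : List (Tree n) → ℚ
  Φ L = sumℚ (map cost L)

  singleton : V → Tree n
  singleton v = mkTree [ v ] []

  singleton-block : ∀ {c v} → v ∈ C c → Block c (singleton v)
  singleton-block v∈C = record
    { isTree = record
        { nonempty  = λ ()
        ; distinct  = [] ∷ []
        ; endpoints = []
        ; connected = λ { _ _ (here refl) (here refl) → here }
        ; edgeCount = refl }
    ; short  = []
    ; inside = λ { (here refl) → v∈C } }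

  graft : ∀ {z} (L : List (Tree n)) → z ∈ᴮ L → Tree n → V → List (Tree n)
  graft {z} (Z ∷ L) (here _)  X x = join Z X z x ∷ L
  graft     (Z ∷ L) (there p) X x = Z ∷ graft L p X x

  module _ {X : Tree n} {x : V} where

    length-graft : ∀ {z} L (p : z ∈ᴮ L) → length (graft L p X x) ≡ length L
    length-graft (Z ∷ L) (here _)  = refl
    length-graft (Z ∷ L) (there p) = cong suc (length-graft L p)

    graft-Φ : ∀ {z} L (p : z ∈ᴮ L) → Φ (graft L p X x) ≡ Φ L + (d z x + weight d X)
    graft-Φ {z} (Z ∷ L) (here _) = begin
      d z x + edgeWeight (edges Z ++ edges X) + R + Φ L
        ≡⟨ cong (λ s → d z x + s + R + Φ L) (edgeWeight-++ (edges Z) (edges X)) ⟩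
      d z x + (weight d Z + weight d X) + R + Φ L
        ≡⟨ solve 5 (λ e z x r l → e :+ (z :+ x) :+ r :+ l := z :+ r :+ l :+ (e :+ x)) refl
                   (d z x) (weight d Z) (weight d X) R (Φ L) ⟩
      weight d Z + R + Φ L + (d z x + weight d X)
        ∎
      where
        open ≡-Reasoning
        open +-*-Solver
    graft-Φ {z} (Z ∷ L) (there p) =
      trans (cong (λ s → cost Z + s) (graft-Φ L p)) (sym (+-assoc (cost Z) (Φ L) (d z x + weight d X)))

    graft-⊇ : ∀ {z v} L (p : z ∈ᴮ L) → v ∈ᴮ L → v ∈ᴮ graft L p X x
    graft-⊇ (Z ∷ L) (here _)  (here v∈Z)  = here (∈-++⁺ˡ v∈Z)
    graft-⊇ (Z ∷ L) (here _)  (there v∈L) = there v∈L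
    graft-⊇ (Z ∷ L) (there p) (here v∈Z)  = here v∈Z
    graft-⊇ (Z ∷ L) (there p) (there v∈L) = there (graft-⊇ L p v∈L)

    graft-∋ : ∀ {z v} L (p : z ∈ᴮ L) → v ∈ verts X → v ∈ᴮ graft L p X x
    graft-∋ (Z ∷ L) (here _)  v∈X = here (∈-++⁺ʳ (verts Z) v∈X)
    graft-∋ (Z ∷ L) (there p) v∈X = there (graft-∋ L p v∈X)

    graft-disjoint : ∀ {z} {Y : Tree n} L (p : z ∈ᴮ L) → Disjoint (verts Y) (verts X) →
                     All (λ Z → Disjoint (verts Y) (verts Z)) L → All (λ Z → Disjoint (verts Y) (verts Z)) (graft L p X x)
    graft-disjoint {Y = Y} (Z ∷ L) (here _)  Y#X (Y#Z ∷ Y#L) = Disjoint-++ʳ {xs = verts Y} {ys = verts Z} Y#Z Y#X ∷ Y#L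
    graft-disjoint {Y = Y} (Z ∷ L) (there p) Y#X (Y#Z ∷ Y#L) = Y#Z ∷ graft-disjoint {Y = Y} L p Y#X Y#L

    graft-blocks : ∀ {c z} L (p : z ∈ᴮ L) → Blocks c L → Block c X → (∀ {v} → v ∈ verts X → ¬ v ∈ᴮ L) →
                   x ∈ verts X → d z x ≤ℚ R → Blocks c (graft L p X x)
    graft-blocks {c} {z} (Z ∷ L) (here z∈Z) (Z-block ∷ L-blocks , Z#L ∷ L-apart) X-block X-fresh x∈X zx-short =
      (ZX-block ∷ L-blocks) , (ZX#L ∷ L-apart)
      where
        module Z = Block Z-block
        module X = Block X-block
        ZX-block : Block c (join Z X z x)
        ZX-block = record
          { isTree = join-isTree Z.isTree X.isTree z∈Z x∈X (λ (v∈Z , v∈X) → X-fresh v∈X (here v∈Z))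
          ; short  = zx-short ∷ AllP.++⁺ Z.short X.short
          ; inside = [ Z.inside , X.inside ]′ ∘ ∈-++⁻ (verts Z) }
        ZX#L : All (λ Y → Disjoint (verts Z ++ verts X) (verts Y)) L
        ZX#L = All.tabulate λ {Y} Y∈L (v∈ZX , v∈Y) →
          [ (λ v∈Z → All.lookup Z#L Y∈L (v∈Z , v∈Y)) , (λ v∈X → X-fresh v∈X (there (lose Y∈L v∈Y))) ]′
            (∈-++⁻ (verts Z) v∈ZX)
    graft-blocks {c} (Z ∷ L) (there p) (Z-block ∷ L-blocks , Z#L ∷ L-apart) X-block X-fresh x∈X zx-short =
      (Z-block ∷ proj₁ rest) ,
      (graft-disjoint {Y = Z} L p (λ (v∈Z , v∈X) → X-fresh v∈X (here v∈Z)) Z#L ∷ proj₂ rest)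
      where
        rest : Blocks c (graft L p X x)
        rest = graft-blocks L p (L-blocks , L-apart) X-block (λ v∈X → X-fresh v∈X ∘ there) x∈X zx-short

  State : Set
  State = Fin m → List (Tree n)

  WellFormed : State → Set
  WellFormed B = ∀ c → Blocks c (B c)

  Covered : State → V → Set
  Covered B v = v ∈ᴮ B (comp v)

  Ψ : State → ℚ
  Ψ B = sumFinℚ (Φ ∘ B)

  record Extension (B : State) (δ : ℚ) (P : V → Set) : Set where
    field
      state      : State
      wellFormed : WellFormed state
      covers     : ∀ {v} → P v → Covered state v
      keeps      : ∀ {v} → Covered B v → Covered state v
      potential  : Ψ state ≤ℚ Ψ B + δ

  stay : ∀ {B δ} {P : V → Set} → WellFormed B → (∀ {v} → P v → Covered B v) → 0ℚ ≤ℚ δ → Extension B δ P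
  stay {B} wf P⊆B 0≤δ = record
    { state = B ; wellFormed = wf ; covers = P⊆B ; keeps = λ v∈B → v∈B ; potential = p≤p+q (Ψ B) 0≤δ }

  infixr 4 _⨾_
  _⨾_ : ∀ {B δ δ′} {P Q : V → Set} (E : Extension B δ P) → Extension (Extension.state E) δ′ Q →
        Extension B (δ + δ′) (λ v → P v ⊎ Q v)
  _⨾_ {B} {δ} {δ′} E E′ = record
    { state      = E′.state
    ; wellFormed = E′.wellFormed
    ; covers     = [ E′.keeps ∘ E.covers , E′.covers ]′
    ; keeps      = E′.keeps ∘ E.keeps
    ; potential  = begin
        Ψ E′.state          ≤⟨ E′.potential ⟩
        Ψ E.state + δ′      ≤⟨ +-monoˡ-≤ δ′ E.potential ⟩
        Ψ B + δ + δ′        ≡⟨ +-assoc (Ψ B) δ δ′ ⟩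
        Ψ B + (δ + δ′)      ∎ }
    where
      module E  = Extension E
      module E′ = Extension E′
      open ≤-Reasoning

  weaken : ∀ {B δ δ′} {P Q : V → Set} → (∀ {v} → Q v → P v) → δ ≤ℚ δ′ →
           Extension B δ P → Extension B δ′ Q
  weaken {B} Q⊆P δ≤δ′ E = record
    { state = E.state ; wellFormed = E.wellFormed ; covers = E.covers ∘ Q⊆P ; keeps = E.keeps
    ; potential = ≤-trans E.potential (+-monoʳ-≤ (Ψ B) δ≤δ′) }
    where module E = Extension E

  update : ∀ {B δ} c L → WellFormed B → Blocks c L → (∀ {v} → v ∈ᴮ B c → v ∈ᴮ L) →
           Φ L ≤ℚ Φ (B c) + δ → Extension B δ (_∈ᴮ L)
  update {B} c L wf L-blocks B⊆L ΦL≤ = record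
    { state      = B′
    ; wellFormed = wellFormed
    ; covers     = λ {v} v∈L →
                     subst (λ c′ → v ∈ᴮ B′ c′) (comp-unique (∈ᴮ-inside L-blocks v∈L)) (at-c v∈L)
    ; keeps      = keeps
    ; potential  = sumFinℚ-updateAt-≤ Φ B c ΦL≤ }
    where
      B′ : State
      B′ = updateAt B c (λ _ → L)
      at-c : ∀ {v} → v ∈ᴮ L → v ∈ᴮ B′ c
      at-c = subst (_ ∈ᴮ_) (sym (updateAt-updates c B))
      wellFormed : WellFormed B′
      wellFormed c′ with c′ FinP.≟ c
      ... | yes refl = subst (Blocks c) (sym (updateAt-updates c B)) L-blocks
      ... | no  c′≢c = subst (Blocks c′) (sym (updateAt-minimal c′ c B c′≢c)) (wf c′)
      keeps : ∀ {v} → Covered B v → Covered B′ v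
      keeps {v} v∈B with comp v FinP.≟ c
      ... | yes refl = at-c (B⊆L v∈B)
      ... | no  c′≢c = subst (v ∈ᴮ_) (sym (updateAt-minimal (comp v) c B c′≢c)) v∈B

  _∈ᴮ?_ : ∀ v L → Dec (v ∈ᴮ L)
  v ∈ᴮ? L = any? (λ X → v ∈? verts X) L

  addSingleton : ∀ {B v} → WellFormed B → ¬ Covered B v → Extension B R (_≡ v)
  addSingleton {B} {v} wf v∉B = weaken (λ { refl → here (here refl) }) ≤-refl
    (update (comp v) (singleton v ∷ L) wf blocks there
            (≤-reflexive (trans (cong (_+ Φ L) (+-identityˡ R)) (+-comm R (Φ L)))))
    where
      L : List (Tree n)
      L = B (comp v)
      blocks : Blocks (comp v) (singleton v ∷ L)
      blocks = (singleton-block (∈-comp v) ∷ proj₁ (wf (comp v)))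
             , (All.tabulate (λ Y∈L → λ { (here refl , v∈Y) → v∉B (lose Y∈L v∈Y) }) ∷ proj₂ (wf (comp v)))

  coverVertex : ∀ {B} → WellFormed B → ∀ v → Extension B R (_≡ v)
  coverVertex {B} wf v with v ∈ᴮ? B (comp v)
  ... | yes v∈B = stay wf (λ { refl → v∈B }) R-nonNeg
  ... | no  v∉B = addSingleton wf v∉B

  coverEdge : ∀ {B a} → WellFormed B → Covered B a → ∀ b → Extension B (d a b) (_≡ b)
  coverEdge {B} {a} wf a∈B b with b ∈ᴮ? B (comp b)
  ... | yes b∈B = stay wf (λ { refl → b∈B }) (d-nonNeg a b)
  ... | no  b∉B with d a b ≤? R
  ...   | no  long  = weaken id (<⇒≤ (≰⇒> long)) (addSingleton wf b∉B)
  ...   | yes short = weaken (λ { refl → graft-∋ L a∈B (here refl) }) ≤-refl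
                        (update (comp a) (graft L a∈B (singleton b) b) wf blocks (graft-⊇ L a∈B)
                                (≤-reflexive (trans (graft-Φ L a∈B) (cong (λ s → Φ L + s) (+-identityʳ (d a b))))))
    where
      L : List (Tree n)
      L = B (comp a)
      blocks : Blocks (comp a) (graft L a∈B (singleton b) b)
      blocks = graft-blocks L a∈B (wf (comp a))
                 (singleton-block (IsComponent.closed (C-component (comp a)) a b (∈-comp a) short))
                 (λ { (here refl) b∈L → b∉B (subst (λ c → b ∈ᴮ B c) (comp-short short) b∈L) })
                 (here refl) short

  coverOrder : ∀ {E vis st fin B} → PrimOrder E vis st fin → WellFormed B → (∀ {v} → v ∈ vis → Covered B v) →
               Extension B (edgeWeight st) (_∈ fin)
  coverOrder done                        wf vis⊆B = stay wf vis⊆B ≤-refl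
  coverOrder {B = B} (extend {a = a} {b = b} a∈vis _ _ po) wf vis⊆B =
    weaken inj₂ ≤-refl (E ⨾ coverOrder po E.wellFormed λ { (here refl) → E.covers refl
                                                         ; (there v∈vis) → E.keeps (vis⊆B v∈vis) })
    where
      E : Extension B (d a b) (_≡ b)
      E = coverEdge wf (vis⊆B a∈vis) b
      module E = Extension E

  coverTree : ∀ {B T} → IsTree T → WellFormed B → Extension B (weight d T + R) (_∈ verts T)
  coverTree {B} {T} T-tree wf =
    weaken (inj₂ ∘ O.spans) (≤-reflexive (trans (cong (λ s → R + s) (sym O.weight≡)) (+-comm R (weight d T))))
           (E ⨾ coverOrder O.isOrder E.wellFormed λ { (here refl) → E.covers refl })
    where
      r : ∃ (_∈ verts T)
      r = root T-tree
      module O = SpanningOrder (spanningOrder T-tree (proj₂ r))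
      E : Extension B R (_≡ proj₁ r)
      E = coverVertex wf (proj₁ r)
      module E = Extension E

  coverAll : ∀ {B k} (T : Fin k → Tree n) → (∀ i → IsTree (T i)) → WellFormed B →
             Extension B (sumFinℚ (λ i → weight d (T i) + R)) (λ v → ∃ λ i → v ∈ verts (T i))
  coverAll {k = zero}  T trees wf = stay wf (λ { (() , _) }) ≤-refl
  coverAll {B} {suc k} T trees wf =
    weaken split ≤-refl (E ⨾ coverAll (T ∘ suc) (trees ∘ suc) (Extension.wellFormed E))
    where
      E : Extension B (weight d (T zero) + R) (_∈ verts (T zero))
      E = coverTree (trees zero) wf
      split : ∀ {v} → (∃ λ i → v ∈ verts (T i)) → v ∈ verts (T zero) ⊎ (∃ λ i → v ∈ verts (T (suc i)))
      split (zero  , v∈T) = inj₁ v∈T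
      split (suc i , v∈T) = inj₂ (i , v∈T)

  GRConn⇒Star : ∀ {u v} → GRConn d R u v → Star (λ x y → d x y ≤ℚ R) u v
  GRConn⇒Star here              = ε
  GRConn⇒Star (step uw≤R w⟶⋆v) = uw≤R ◅ GRConn⇒Star w⟶⋆v

  record Merge (c : Fin m) (L : List (Tree n)) : Set where
    field
      merged  : List (Tree n)
      blocks  : Blocks c merged
      spans   : ∀ {v} → v ∈ C c → v ∈ᴮ merged
      cheaper : Φ merged ≤ℚ Φ L
      shorter : suc (length merged) ≡ length L

  mergeHead : ∀ {c X Y L} → Blocks c (X ∷ Y ∷ L) → (∀ {v} → v ∈ C c → v ∈ᴮ X ∷ Y ∷ L) →
              Merge c (X ∷ Y ∷ L)
  mergeHead {c} {X} {Y} {L} (X-block ∷ YL-blocks , X#YL ∷ YL-apart) spans = record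
    { merged  = graft (Y ∷ L) b∈YL X a
    ; blocks  = graft-blocks (Y ∷ L) b∈YL (YL-blocks , YL-apart) X-block X-fresh a∈X ba≤R
    ; spans   = λ v∈C → case spans v∈C of λ { (here v∈X) → graft-∋ (Y ∷ L) b∈YL v∈X
                                            ; (there v∈YL) → graft-⊇ (Y ∷ L) b∈YL v∈YL }
    ; cheaper = begin
        Φ (graft (Y ∷ L) b∈YL X a)         ≡⟨ graft-Φ (Y ∷ L) b∈YL ⟩
        Φ (Y ∷ L) + (d b a + weight d X)   ≤⟨ +-monoʳ-≤ (Φ (Y ∷ L)) (+-monoˡ-≤ (weight d X) ba≤R) ⟩
        Φ (Y ∷ L) + (R + weight d X)       ≡⟨ solve 3 (λ l r x → l :+ (r :+ x) := x :+ r :+ l) refl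
                                                        (Φ (Y ∷ L)) R (weight d X) ⟩
        Φ (X ∷ Y ∷ L)                      ∎
    ; shorter = cong suc (length-graft (Y ∷ L) b∈YL) }
    where
      open ≤-Reasoning
      open +-*-Solver
      module X = Block X-block
      module Y = Block (All.head YL-blocks)
      X-fresh : ∀ {v} → v ∈ verts X → ¬ v ∈ᴮ Y ∷ L
      X-fresh v∈X v∈YL with find v∈YL
      ... | Z , Z∈YL , v∈Z = All.lookup X#YL Z∈YL (v∈X , v∈Z)
      x : ∃ (_∈ verts X)
      x = root X.isTree
      y : ∃ (_∈ verts Y)
      y = root Y.isTree
      x⟶⋆y : Star (λ u v → d u v ≤ℚ R) (proj₁ x) (proj₁ y)
      x⟶⋆y = GRConn⇒Star (IsComponent.connected (C-component c) (proj₁ x) (proj₁ y)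
                                                 (X.inside (proj₂ x)) (Y.inside (proj₂ y)))
      open Crossing (Star-crossing (_∈? verts X) x⟶⋆y (proj₂ x) (λ y∈X → X-fresh y∈X (here (proj₂ y))))
        renaming (from to a; to to b; link to ab≤R; from-in to a∈X; to-out to b∉X)
      ba≤R : d b a ≤ℚ R
      ba≤R = subst (_≤ℚ R) (d-sym a b) ab≤R
      b∈YL : b ∈ᴮ Y ∷ L
      b∈YL with spans (IsComponent.closed (C-component c) a b (X.inside a∈X) ab≤R)
      ... | here b∈X   = ⊥-elim (b∉X b∈X)
      ... | there b∈YL = b∈YL

  joinBlocks : ∀ {c} k L → length L ≡ k → Blocks c L → (∀ {v} → v ∈ C c → v ∈ᴮ L) →
               ∃ λ T → IsSpanningTreeInGR d R (C c) T × cost T ≤ℚ Φ L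
  joinBlocks {c} _ [] _ _ spans with spans (proj₂ (≢[]⇒∃∈ (C c) (IsComponent.nonempty (C-component c))))
  ... | ()
  joinBlocks _ (X ∷ []) _ (X-block ∷ [] , _) spans =
    X , (X.isTree , X.short , λ v → mk⇔ X.inside (λ v∈C → case spans v∈C of λ { (here v∈X) → v∈X })) ,
    ≤-reflexive (sym (+-identityʳ (cost X)))
    where module X = Block X-block
  joinBlocks zero    (X ∷ Y ∷ L) ()
  joinBlocks (suc k) (X ∷ Y ∷ L) |L|≡ blocks spans =
    map₂ (map₂ (λ cost≤ → ≤-trans cost≤ M.cheaper))
         (joinBlocks k M.merged (ℕP.suc-injective (trans M.shorter |L|≡)) M.blocks M.spans)
    where module M = Merge (mergeHead blocks spans)

  mst-cost-bound : ∀ {k} (T : Fin k → Tree n) → IsTreeCover T →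
                   (TC : Fin m → Tree n) → (∀ c → IsMSTInGR d R (C c) (TC c)) →
                   sumFinℚ (λ c → weight d (TC c) + R) ≤ℚ sumFinℚ (λ i → weight d (T i) + R)
  mst-cost-bound T (trees , covering) TC mst = begin
    sumFinℚ (λ c → cost (TC c))  ≤⟨ sumFinℚ-mono MST≤Φ ⟩
    Ψ E.state                    ≤⟨ E.potential ⟩
    Ψ (λ _ → []) + δ             ≡⟨ cong (_+ δ) (trans (sumFinℚ-const m 0ℚ) (*-zeroʳ (fromℤ (+ m)))) ⟩
    0ℚ + δ                       ≡⟨ +-identityˡ δ ⟩
    δ                            ∎
    where
      open ≤-Reasoning
      δ : ℚ
      δ = sumFinℚ (λ i → weight d (T i) + R)
      module E = Extension (coverAll {B = λ _ → []} T trees (λ _ → [] , []))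
      spans : ∀ c {v} → v ∈ C c → v ∈ᴮ E.state c
      spans c {v} v∈C = subst (λ c′ → v ∈ᴮ E.state c′) (sym (comp-unique v∈C)) (E.covers (covering v))
      MST≤Φ : ∀ c → cost (TC c) ≤ℚ Φ (E.state c)
      MST≤Φ c with joinBlocks _ (E.state c) refl (E.wellFormed c) (spans c)
      ... | T′ , T′-spanning , cost≤ = ≤-trans (+-monoˡ-≤ R (proj₂ (mst c) T′ T′-spanning)) cost≤

lemma2 : (n : ℕ) (d : Fin n → Fin n → ℚ) → IsMetric d →
         (k : ℕ) → 1 ≤ k → (R : ℚ) (R>0 : 0ℚ < R) →
         -- the components C_1, …, C_m of G_R (listed without repetition)
         (m : ℕ) (C : Fin m → List (Fin n)) →
         (∀ i → IsComponent d R (C i)) →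
         (∀ i j → i ≢ j → ∀ v → v ∈ C i → ¬ (v ∈ C j)) →
         (∀ v → ∃ λ i → v ∈ C i) →
         -- T_C : a minimum-weight spanning tree of C in G_R
         (TC : Fin m → Tree n) → (∀ i → IsMSTInGR d R (C i) (TC i)) →
         sumFinℤ (λ i → allot R R>0 (weight d (TC i))) ≡ + k →
         -- the trees of 𝒯 coming from each component
         (P : Fin m → List (Tree n)) → (∀ i → IsContribution d R (TC i) (P i)) →
         length (concat (map P (allFin m))) ≡ k →
         -- comparison with every tree cover of size k
         (cover : Fin k → Tree n) → IsTreeCover cover →
         sumℚ (map (weight d) (concat (map P (allFin m))))
           ≤ℚ (sumFinℚ (λ i → weight d (cover i)) + sumFinℚ (λ i → weight d (cover i)))
lemma2 n d metric k _ R R>0 m C components disjoint covering TC mst Σallot≡k P contributions _ cover isCover =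
  begin
    sumℚ (map (weight d) (concat (map P (allFin m))))  ≡⟨ sumℚ-map-concat-allFin (weight d) P ⟩
    sumFinℚ (λ c → sumℚ (map (weight d) (P c)))       ≤⟨ sumFinℚ-mono (λ c → contribution-≤ {R} (contributions c)) ⟩
    W                                                  ≤⟨ ≤-double W mR OPT kR spanning-bound allotment-bound ⟩
    OPT + OPT                                          ∎
  where
    open ≤-Reasoning
    open WeightedGraph d (IsMetric.symm metric) (metric-nonNeg metric)
    open Forest d (IsMetric.symm metric) (metric-nonNeg metric) R (<⇒≤ R>0) C components disjoint covering
    W OPT mR kR : ℚ
    W   = sumFinℚ (λ c → weight d (TC c))
    OPT = sumFinℚ (λ i → weight d (cover i))
    mR  = sumFinℚ {m} (λ _ → R)
    kR  = sumFinℚ {k} (λ _ → R)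
    spanning-bound : W + mR ≤ℚ OPT + kR
    spanning-bound = subst₂ _≤ℚ_ (sumFinℚ-+ (λ c → weight d (TC c)) (λ _ → R))
                                 (sumFinℚ-+ (λ i → weight d (cover i)) (λ _ → R))
                                 (mst-cost-bound cover isCover TC mst)
    allotment-bound : kR + kR ≤ℚ W + (mR + mR)
    allotment-bound = subst₂ _≤ℚ_ (sumFinℚ-+ {k} (λ _ → R) (λ _ → R))
                                  (trans (sumFinℚ-+ (λ c → weight d (TC c)) (λ _ → R + R))
                                         (cong (λ s → W + s) (sumFinℚ-+ {m} (λ _ → R) (λ _ → R))))
                                  (allot-sum-bound R R>0 (λ c → weight d (TC c)) k Σallot≡k)
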